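{- Let $H$ be a graph and $\mathcal{E}'$ an edge-tangle of order $\theta$ in $H$. Let $G$ be a graph containing an $H$-immersion $(\pi_V,\pi_E)$. If $\mathcal{E}$ is the set of all edge-cuts $[A,B]$ of $G$ of order less than $\theta$ such that there exists $[A',B']\in\mathcal{E}'$ with $\pi_V(A')=A\cap\pi_V(V(H))$, then $\mathcal{E}$ is an edge-tangle of order $\theta$ in $G$.
   Context: Graphs are finite and may have loops and parallel edges; a loop is a cycle. An $H$-immersion in $G$ is a pair $(\pi_V,\pi_E)$ with $\pi_V:V(H)\to V(G)$ injective, $\pi_E$ mapping each non-loop edge of $H$ with ends $x,y$ to a path of $G$ with ends $\pi_V(x),\pi_V(y)$ and each loop of $H$ at $v$ to a cycle of $G$ containing $\pi_V(v)$, with images of distinct edges edge-disjoint. For a set $S$, $\pi_V(S)=\{\pi_V(x):x\in S\}$. An edge-cut of a graph $F$ is an ordered partition $[A,B]$ of $V(F)$ (parts may be empty), of order equal to the number of edges with one end in $A$ and one in $B$. An edge-tangle of order $\theta$ in $F$ is a set $\mathcal{E}$ of edge-cuts of order less than $\theta$ with (E1) for every edge-cut $[A,B]$ of order less than $\theta$, $[A,B]\in\mathcal{E}$ or $[B,A]\in\mathcal{E}$; (E2) if $[A_i,B_i]\in\mathcal{E}$, $i=1,2,3$, then $B_1\cap B_2\cap B_3\ne\emptyset$; (E3) if $[A,B]\in\mathcal{E}$ then at least $\theta$ edges of $F$ are incident with vertices of $B$. -}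

module Defs where

open import Data.Nat using (ℕ; zero; suc; _+_; _<_; _≤_)
open import Data.Fin using (Fin; zero; suc; fromℕ; inject₁)
open import Data.Bool using (Bool; true; false; not; _xor_; _∨_; if_then_else_)
open import Data.Product using (_×_; _,_; proj₁; proj₂; Σ; ∃)
open import Data.Sum using (_⊎_)
open import Function using (_∘_)
open import Function.Definitions using (Injective)
open import Relation.Binary.PropositionalEquality using (_≡_; _≢_)
open import Relation.Nullary using (¬_)
open import Data.Empty using (⊥)
open import Data.Unit using (⊤)

-- A finite multigraph (loops and parallel edges allowed):
-- vertices Fin nV, edges Fin nE, each edge with its two ends.
record Graph : Set where
  field
    nV : ℕ
    nE : ℕ
    ends : Fin nE → Fin nV × Fin nV
open Graph public

V : Graph → Set
V G = Fin (nV G)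

E : Graph → Set
E G = Fin (nE G)

Joins : (G : Graph) → E G → V G → V G → Set
Joins G e a b = (ends G e ≡ (a , b)) ⊎ (ends G e ≡ (b , a))

record Path (G : Graph) (x y : V G) : Set where
  field
    len : ℕ
    vs : Fin (suc len) → V G
    es : Fin len → E G
    vs-inj : Injective _≡_ _≡_ vs
    start : vs zero ≡ x
    end : vs (fromℕ len) ≡ y
    joins : ∀ i → Joins G (es i) (vs (inject₁ i)) (vs (suc i))
open Path public

cycSuc : ∀ {k} → Fin (suc k) → Fin (suc k)
cycSuc {zero} zero = zero
cycSuc {suc k} zero = suc zero
cycSuc {suc k} (suc i) with cycSuc {k} i
... | zero = zero
... | suc j = suc (suc j)

-- A cycle of length suc k ≥ 1: distinct vertices vs 0 … vs k, distinct edges,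
-- edge es i joining vs i and vs (i+1 mod (suc k)).  (A loop is a cycle of
-- length 1, two parallel edges form a cycle of length 2.)
record Cycle (G : Graph) : Set where
  field
    k : ℕ
    cvs : Fin (suc k) → V G
    ces : Fin (suc k) → E G
    cvs-inj : Injective _≡_ _≡_ cvs
    ces-inj : Injective _≡_ _≡_ ces
    cjoins : ∀ i → Joins G (ces i) (cvs i) (cvs (cycSuc i))
open Cycle public

PathUses : ∀ {G x y} → Path G x y → E G → Set
PathUses P e = ∃ λ i → es P i ≡ e

CycleUses : ∀ {G} → Cycle G → E G → Set
CycleUses C e = ∃ λ i → ces C i ≡ e

CycleContains : ∀ {G} → Cycle G → V G → Set
CycleContains C v = ∃ λ i → cvs C i ≡ v

EdgeImage : (H G : Graph) → (V H → V G) → E H → Set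
EdgeImage H G πV f =
  (proj₁ (ends H f) ≢ proj₂ (ends H f) × Path G (πV (proj₁ (ends H f))) (πV (proj₂ (ends H f))))
  ⊎ (proj₁ (ends H f) ≡ proj₂ (ends H f) × Σ (Cycle G) (λ C → CycleContains C (πV (proj₁ (ends H f)))))

ImageUses : (H G : Graph) (πV : V H → V G) (f : E H) → EdgeImage H G πV f → E G → Set
ImageUses H G πV f (Data.Sum.inj₁ (_ , P)) e = PathUses P e
ImageUses H G πV f (Data.Sum.inj₂ (_ , (C , _))) e = CycleUses C e

record Immersion (H G : Graph) : Set where
  field
    πV : V H → V G
    πV-inj : Injective _≡_ _≡_ πV
    πE : (f : E H) → EdgeImage H G πV f
    disjoint : ∀ f f' e → f ≢ f' → ImageUses H G πV f (πE f) e → ImageUses H G πV f' (πE f') e → ⊥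
open Immersion public

count : ∀ {m} → (Fin m → Bool) → ℕ
count {zero} p = 0
count {suc m} p = (if p zero then 1 else 0) + count (p ∘ suc)

-- An edge-cut [A,B] of G: A = vertices mapped to true, B = those mapped to false.
Cut : Graph → Set
Cut G = V G → Bool

InA : (G : Graph) → Cut G → V G → Set
InA G c v = c v ≡ true

InB : (G : Graph) → Cut G → V G → Set
InB G c v = c v ≡ false

swap : (G : Graph) → Cut G → Cut G
swap G c = not ∘ c

order : (G : Graph) → Cut G → ℕ
order G c = count (λ e → c (proj₁ (ends G e)) xor c (proj₂ (ends G e)))

incidentB : (G : Graph) → Cut G → ℕ
incidentB G c = count (λ e → not (c (proj₁ (ends G e))) ∨ not (c (proj₂ (ends G e))))

record IsEdgeTangle (G : Graph) (θ : ℕ) (𝓔 : Cut G → Set) : Set where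
  field
    small : ∀ c → 𝓔 c → order G c < θ
    E1 : ∀ c → order G c < θ → 𝓔 c ⊎ 𝓔 (swap G c)
    E2 : ∀ c₁ c₂ c₃ → 𝓔 c₁ → 𝓔 c₂ → 𝓔 c₃ → ∃ λ v → InB G c₁ v × InB G c₂ v × InB G c₃ v
    E3 : ∀ c → 𝓔 c → θ ≤ incidentB G c

ImageOf : (H G : Graph) → (V H → V G) → (V H → Set) → V G → Set
ImageOf H G πV S v = ∃ λ x → S x × πV x ≡ v

Induced : (H G : Graph) → Immersion H G → ℕ → (Cut H → Set) → Cut G → Set
Induced H G π θ 𝓔' c =
  order G c < θ ×
  ∃ λ c' → 𝓔' c' ×
    (∀ v → (ImageOf H G (πV π) (InA H c') v → InA G c v × ImageOf H G (πV π) (λ _ → ⊤) v)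
         × (InA G c v × ImageOf H G (πV π) (λ _ → ⊤) v → ImageOf H G (πV π) (InA H c') v))

-- Pulling a cut [A,B] of G back along the vertex map gives the cut
-- [π⁻¹(A), π⁻¹(B)] of H.  Every edge of H crossing (resp. touching B in) the
-- pulled-back cut has an image path or cycle containing an edge crossing
-- (resp. touching B in) the original cut, and images of distinct edges are
-- edge-disjoint; so pulling back does not increase the order and does not
-- decrease the number of edges incident with B.  Since membership in the
-- induced family only depends on the pulled-back cut, the axioms of the
-- tangle in H transfer to G.
module Submission where

open import Defs
open import Data.Nat using (ℕ; zero; suc; _+_; _<_; _≤_; z≤n; s≤s)
open import Data.Nat.Properties using (≤-trans; ≤-<-trans; ≤-reflexive)
open import Data.Fin using (Fin; zero; suc; fromℕ; inject₁)
open import Data.Fin.Properties using (_≟_; suc-injective)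
open import Data.Bool using (Bool; true; false; not; _xor_; _∨_; if_then_else_)
open import Data.Bool.Properties using (∨-zeroʳ; xor-same; not-involutive) renaming (_≟_ to _≟ᵇ_)
open import Data.Product using (_×_; _,_; proj₁; proj₂; ∃)
open import Data.Sum using (_⊎_; inj₁; inj₂)
open import Data.Empty using (⊥-elim)
open import Data.Unit using (⊤; tt)
open import Function using (_∘_)
open import Relation.Nullary using (yes; no; does)
open import Relation.Binary.PropositionalEquality

count-cong : ∀ {m} {p q : Fin m → Bool} → p ≗ q → count p ≡ count q
count-cong {zero} p≗q = refl
count-cong {suc m} {p} {q} p≗q =
  cong₂ (λ b k → (if b then 1 else 0) + k) (p≗q zero) (count-cong (p≗q ∘ suc))

unmark : ∀ {n} → (Fin n → Bool) → Fin n → Fin n → Bool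
unmark q i j = if does (j ≟ i) then false else q j

unmark-≢ : ∀ {n} (q : Fin n → Bool) {i j} → j ≢ i → unmark q i j ≡ q j
unmark-≢ q {i} {j} j≢i with j ≟ i
... | yes j≡i = ⊥-elim (j≢i j≡i)
... | no _ = refl

count-unmark : ∀ {n} (q : Fin n → Bool) i → q i ≡ true → count q ≡ suc (count (unmark q i))
count-unmark {suc n} q zero qi rewrite qi = refl
count-unmark {suc n} q (suc i) qi
  rewrite count-cong {p = unmark q (suc i) ∘ suc} {q = unmark (q ∘ suc) i} (λ _ → refl)
        | count-unmark (q ∘ suc) i qi
  with q zero
... | true = refl
... | false = refl

count-≤-injection : ∀ {m n} (p : Fin m → Bool) (q : Fin n → Bool) (g : ∀ i → p i ≡ true → Fin n) →
  (∀ i pi → q (g i pi) ≡ true) → (∀ i j pi pj → g i pi ≡ g j pj → i ≡ j) → count p ≤ count q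
count-≤-injection {zero} p q g g-q g-inj = z≤n
count-≤-injection {suc m} p q g g-q g-inj with p zero in p0
... | false = count-≤-injection (p ∘ suc) q (g ∘ suc) (g-q ∘ suc)
                (λ i j pi pj eq → suc-injective (g-inj (suc i) (suc j) pi pj eq))
... | true = ≤-trans (s≤s rest) (≤-reflexive (sym (count-unmark q (g zero p0) (g-q zero p0))))
  where
  g-avoids : ∀ i pi → g (suc i) pi ≢ g zero p0
  g-avoids i pi eq with g-inj (suc i) zero pi p0 eq
  ... | ()
  rest : count (p ∘ suc) ≤ count (unmark q (g zero p0))
  rest = count-≤-injection (p ∘ suc) (unmark q (g zero p0)) (g ∘ suc)
           (λ i pi → trans (unmark-≢ q (g-avoids i pi)) (g-q (suc i) pi))
           (λ i j pi pj eq → suc-injective (g-inj (suc i) (suc j) pi pj eq))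

adjacent-≢ : ∀ n (f : Fin (suc n) → Bool) → f zero ≢ f (fromℕ n) → ∃ λ i → f (inject₁ i) ≢ f (suc i)
adjacent-≢ zero f f0≢fn = ⊥-elim (f0≢fn refl)
adjacent-≢ (suc n) f f0≢fn with f zero ≟ᵇ f (suc zero)
... | no f0≢f1 = zero , f0≢f1
... | yes f0≡f1 with adjacent-≢ n (f ∘ suc) (f0≢fn ∘ trans f0≡f1)
... | i , fi≢fi+1 = suc i , fi≢fi+1

≢⇒xor≡true : ∀ {a b} → a ≢ b → a xor b ≡ true
≢⇒xor≡true {true} {true} a≢b = ⊥-elim (a≢b refl)
≢⇒xor≡true {true} {false} _ = refl
≢⇒xor≡true {false} {true} _ = refl
≢⇒xor≡true {false} {false} a≢b = ⊥-elim (a≢b refl)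

xor≡true⇒≢ : ∀ {a b} → a xor b ≡ true → a ≢ b
xor≡true⇒≢ {true} {false} _ ()
xor≡true⇒≢ {false} {true} _ ()

not-xor-not : ∀ a b → not a xor not b ≡ a xor b
not-xor-not true b = refl
not-xor-not false b = not-involutive b

not-∨-not : ∀ {a b} → not a ∨ not b ≡ true → a ≡ false ⊎ b ≡ false
not-∨-not {false} _ = inj₁ refl
not-∨-not {true} {false} _ = inj₂ refl

module _ (G : Graph) where

  crossing : Cut G → E G → Bool
  crossing c e = c (proj₁ (ends G e)) xor c (proj₂ (ends G e))

  touchesB : Cut G → E G → Bool
  touchesB c e = not (c (proj₁ (ends G e))) ∨ not (c (proj₂ (ends G e)))

  order-swap : ∀ c → order G (swap G c) ≡ order G c
  order-swap c = count-cong λ e → not-xor-not (c (proj₁ (ends G e))) (c (proj₂ (ends G e)))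

  incidentB-cong : ∀ {c d} → c ≗ d → incidentB G c ≡ incidentB G d
  incidentB-cong c≗d = count-cong λ e → cong₂ (λ a b → not a ∨ not b) (c≗d (proj₁ (ends G e))) (c≗d (proj₂ (ends G e)))

  Joins-sym : ∀ {e u w} → Joins G e u w → Joins G e w u
  Joins-sym (inj₁ eq) = inj₂ eq
  Joins-sym (inj₂ eq) = inj₁ eq

  Joins⇒crossing : ∀ c {e u w} → Joins G e u w → c u ≢ c w → crossing c e ≡ true
  Joins⇒crossing c (inj₁ eq) cu≢cw rewrite eq = ≢⇒xor≡true cu≢cw
  Joins⇒crossing c (inj₂ eq) cu≢cw rewrite eq = ≢⇒xor≡true (cu≢cw ∘ sym)

  Joins⇒touchesB : ∀ c {e u w} → Joins G e u w → c u ≡ false → touchesB c e ≡ true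
  Joins⇒touchesB c (inj₁ eq) cu rewrite eq | cu = refl
  Joins⇒touchesB c (inj₂ eq) cu rewrite eq | cu = ∨-zeroʳ _

  Path-crossing : ∀ c {x y} (P : Path G x y) → c x ≢ c y → ∃ λ e → crossing c e ≡ true × PathUses P e
  Path-crossing c P cx≢cy with adjacent-≢ (len P) (c ∘ vs P) cvs0≢cvsn
    where
    cvs0≢cvsn : c (vs P zero) ≢ c (vs P (fromℕ (len P)))
    cvs0≢cvsn eq = cx≢cy (trans (cong c (sym (start P))) (trans eq (cong c (end P))))
  ... | i , ci≢ci+1 = es P i , Joins⇒crossing c (joins P i) ci≢ci+1 , i , refl

  Path-touchesB-start : ∀ c {x y} → x ≢ y → (P : Path G x y) → c x ≡ false →
    ∃ λ e → touchesB c e ≡ true × PathUses P e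
  Path-touchesB-start c x≢y record { len = zero ; start = st ; end = en } _ = ⊥-elim (x≢y (trans (sym st) en))
  Path-touchesB-start c x≢y record { len = suc _ ; es = es ; start = st ; joins = jn } cx =
    es zero , Joins⇒touchesB c (jn zero) (trans (cong c st) cx) , zero , refl

  Path-touchesB-end : ∀ c {x y} → x ≢ y → (P : Path G x y) → c y ≡ false →
    ∃ λ e → touchesB c e ≡ true × PathUses P e
  Path-touchesB-end c x≢y record { len = zero ; start = st ; end = en } _ = ⊥-elim (x≢y (trans (sym st) en))
  Path-touchesB-end c x≢y record { len = suc l ; es = es ; end = en ; joins = jn } cy =
    es (fromℕ l) , Joins⇒touchesB c (Joins-sym (jn (fromℕ l))) (trans (cong c en) cy) , fromℕ l , refl

module _ {H G : Graph} (π : Immersion H G) where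

  pullback : Cut G → Cut H
  pullback c = c ∘ πV π

  UsesImage : E H → E G → Set
  UsesImage f = ImageUses H G (πV π) f (πE π f)

  count-≤-via-images : (p : E H → Bool) (q : E G → Bool) →
    (∀ f → p f ≡ true → ∃ λ e → q e ≡ true × UsesImage f e) → count p ≤ count q
  count-≤-via-images p q image-edge =
    count-≤-injection p q (λ f pf → proj₁ (image-edge f pf)) (λ f pf → proj₁ (proj₂ (image-edge f pf))) distinct
    where
    distinct : ∀ f f' pf pf' → proj₁ (image-edge f pf) ≡ proj₁ (image-edge f' pf') → f ≡ f'
    distinct f f' pf pf' eq with f ≟ f'
    ... | yes f≡f' = f≡f'
    ... | no f≢f' = ⊥-elim (disjoint π f f' _ f≢f' (proj₂ (proj₂ (image-edge f pf)))
                      (subst (UsesImage f') (sym eq) (proj₂ (proj₂ (image-edge f' pf')))))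

  module _ (c : Cut G) where

    image-crossing : ∀ f → crossing H (pullback c) f ≡ true → (im : EdgeImage H G (πV π) f) →
      ∃ λ e → crossing G c e ≡ true × ImageUses H G (πV π) f im e
    image-crossing f cross (inj₁ (_ , P)) = Path-crossing G c P (xor≡true⇒≢ cross)
    image-crossing f cross (inj₂ (loop , _)) rewrite loop | xor-same (pullback c (proj₂ (ends H f))) with cross
    ... | ()

    image-touchesB : ∀ f → touchesB H (pullback c) f ≡ true → (im : EdgeImage H G (πV π) f) →
      ∃ λ e → touchesB G c e ≡ true × ImageUses H G (πV π) f im e
    image-touchesB f touch (inj₁ (x≢y , P)) with not-∨-not touch
    ... | inj₁ cx = Path-touchesB-start G c (x≢y ∘ πV-inj π) P cx
    ... | inj₂ cy = Path-touchesB-end G c (x≢y ∘ πV-inj π) P cy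
    image-touchesB f touch (inj₂ (loop , C , i , Ci≡x)) =
      ces C i , Joins⇒touchesB G c (cjoins C i) (trans (cong c Ci≡x) cx) , i , refl
      where
      cx : pullback c (proj₁ (ends H f)) ≡ false
      cx with not-∨-not touch
      ... | inj₁ cx = cx
      ... | inj₂ cy = trans (cong (pullback c) loop) cy

    order-pullback-≤ : order H (pullback c) ≤ order G c
    order-pullback-≤ = count-≤-via-images _ _ λ f cross → image-crossing f cross (πE π f)

    incidentB-pullback-≤ : incidentB H (pullback c) ≤ incidentB G c
    incidentB-pullback-≤ = count-≤-via-images _ _ λ f touch → image-touchesB f touch (πE π f)

  AgreesOnImage : Cut G → Cut H → Set
  AgreesOnImage c c' = ∀ v →
    (ImageOf H G (πV π) (InA H c') v → InA G c v × ImageOf H G (πV π) (λ _ → ⊤) v)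
    × (InA G c v × ImageOf H G (πV π) (λ _ → ⊤) v → ImageOf H G (πV π) (InA H c') v)

  pullback-agrees : ∀ c → AgreesOnImage c (pullback c)
  pullback-agrees c v =
    (λ { (x , cx , πx≡v) → subst (InA G c) πx≡v cx , x , tt , πx≡v })
    , λ { (cv , x , _ , πx≡v) → x , subst (InA G c) (sym πx≡v) cv , πx≡v }

  agrees⇒pullback : ∀ {c c'} → AgreesOnImage c c' → c' ≗ pullback c
  agrees⇒pullback {c} {c'} agree x with c' x in c'x | c (πV π x) in cπx
  ... | true | true = refl
  ... | false | false = refl
  ... | true | false = sym (trans (sym cπx) (proj₁ (proj₁ (agree (πV π x)) (x , c'x , refl))))
  ... | false | true with proj₂ (agree (πV π x)) (cπx , x , tt , refl)
  ... | y , c'y , πy≡πx with πV-inj π πy≡πx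
  ... | refl = sym (trans (sym c'y) c'x)

  Induced⇒pullback : ∀ {θ 𝓔' c} → Induced H G π θ 𝓔' c → ∃ λ c' → 𝓔' c' × c' ≗ pullback c
  Induced⇒pullback (_ , c' , c'∈𝓔' , agree) = c' , c'∈𝓔' , agrees⇒pullback agree

lemma2p7 : (H G : Graph) (θ : ℕ) (𝓔' : Cut H → Set) → IsEdgeTangle H θ 𝓔' →
    (π : Immersion H G) → IsEdgeTangle G θ (Induced H G π θ 𝓔')
lemma2p7 H G θ 𝓔' T π = record { small = λ _ → proj₁ ; E1 = E1 ; E2 = E2 ; E3 = E3 }
  where
  open IsEdgeTangle T renaming (E1 to E1'; E2 to E2'; E3 to E3')
  𝓔 = Induced H G π θ 𝓔'

  E1 : ∀ c → order G c < θ → 𝓔 c ⊎ 𝓔 (swap G c)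
  E1 c c<θ with E1' (pullback π c) (≤-<-trans (order-pullback-≤ π c) c<θ)
  ... | inj₁ c∈𝓔' = inj₁ (c<θ , pullback π c , c∈𝓔' , pullback-agrees π c)
  ... | inj₂ c∈𝓔' = inj₂ (subst (_< θ) (sym (order-swap G c)) c<θ , swap H (pullback π c) , c∈𝓔'
                         , pullback-agrees π (swap G c))

  E2 : ∀ c₁ c₂ c₃ → 𝓔 c₁ → 𝓔 c₂ → 𝓔 c₃ → ∃ λ v → InB G c₁ v × InB G c₂ v × InB G c₃ v
  E2 c₁ c₂ c₃ i₁ i₂ i₃ with Induced⇒pullback π i₁ | Induced⇒pullback π i₂ | Induced⇒pullback π i₃
  ... | d₁ , d₁∈𝓔' , d₁≗ | d₂ , d₂∈𝓔' , d₂≗ | d₃ , d₃∈𝓔' , d₃≗ with E2' d₁ d₂ d₃ d₁∈𝓔' d₂∈𝓔' d₃∈𝓔'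
  ... | x , x∈B₁ , x∈B₂ , x∈B₃ =
    πV π x , trans (sym (d₁≗ x)) x∈B₁ , trans (sym (d₂≗ x)) x∈B₂ , trans (sym (d₃≗ x)) x∈B₃

  E3 : ∀ c → 𝓔 c → θ ≤ incidentB G c
  E3 c c∈𝓔 with Induced⇒pullback π c∈𝓔
  ... | d , d∈𝓔' , d≗ =
    ≤-trans (E3' d d∈𝓔') (≤-trans (≤-reflexive (incidentB-cong H d≗)) (incidentB-pullback-≤ π c))
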